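{- Let $M\ge2$, let $A=X_1X_2\cdots X_n$ be a string over an alphabet $\Sigma$ consisting of $n$ blocks each of length $M$, and run the Least-Frequent-Character scheme described in the context on $A$. Let $k_1<k_2<\dots<k_n$ be the $n$ positions of $S$ selected in the $n$ iterations. Then $k_i\le(i-1)M+1$ for all $i\in[n]$.
   Context: Least-Frequent-Character (LFC) scheme: fix a bijection $\sigma:\Sigma\to[|\Sigma|]$ such that, for distinct characters $x,y$, $|A|_x>|A|_y$ implies $\sigma(x)>\sigma(y)$, where $|A|_c$ is the number of occurrences of $c$ in $A$. Let $S$ be the string of length $nM$ obtained by concatenating, for $i=1,\dots,|\Sigma|$, $|A|_{\sigma^{ -1}(i)}$ copies of $\sigma^{ -1}(i)$. Let $\lambda\notin\Sigma$ be a blank symbol; initially all blocks are unflagged. Repeat $n$ times: let $k$ be the smallest index with $S[k]\ne\lambda$ (this is the selected position) and $c=S[k]$; choose the unflagged block $X_j$ of smallest index $j$ containing $c$ and flag it; for each character $l$ in $X_j$ (with multiplicity), replace the leftmost occurrence of $l$ in $S$ by $\lambda$; finally replace the leftmost occurrence of $c$ in $X_j$ by $\lambda$. -}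

module Defs where

open import Data.Nat using (ℕ; zero; suc; _+_; _*_; _<_)
open import Data.Bool using (Bool; true; false; if_then_else_)
open import Data.Fin as Fin using (Fin; toℕ)
open import Data.Fin.Properties using (_≟_)
open import Data.List as List using (List; []; _∷_; replicate; concatMap; allFin)
open import Data.Vec as Vec using (Vec; toList; lookup; _[_]≔_)
open import Data.Maybe using (Maybe; just; nothing; _>>=_)
open import Data.Product using (_×_; _,_)
open import Function.Bundles using (_↔_; Inverse)
open import Relation.Nullary using (does; ¬_)
open import Relation.Binary.PropositionalEquality using (_≡_)

-- The alphabet Σ is modelled as Fin m (any finite alphabet, |Σ| = m).
-- A string A = X₁ X₂ ⋯ Xₙ of n blocks of length M is a Vec of n blocks.

flat : ∀ {m M n} → Vec (Vec (Fin m) M) n → List (Fin m)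
flat X = concatMap toList (toList X)

countIn : ∀ {m} → Fin m → List (Fin m) → ℕ
countIn c [] = 0
countIn c (x ∷ xs) = if does (c ≟ x) then suc (countIn c xs) else countIn c xs

occ : ∀ {m M n} → Fin m → Vec (Vec (Fin m) M) n → ℕ
occ c X = countIn c (flat X)

IsLFC : ∀ {m M n} → Vec (Vec (Fin m) M) n → Fin m ↔ Fin m → Set
IsLFC X σ = ∀ x y → ¬ (x ≡ y) → occ y X < occ x X → Inverse.to σ y Fin.< Inverse.to σ x

initS : ∀ {m M n} → Vec (Vec (Fin m) M) n → Fin m ↔ Fin m → List (Fin m)
initS X σ = concatMap (λ i → replicate (occ (Inverse.from σ i) X) (Inverse.from σ i)) (allFin _)

-- Strings with blanks: `nothing` is the blank symbol λ.

-- smallest (0-based) index k with S[k] ≠ λ, together with S[k]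
firstNonBlank : ∀ {m} → List (Maybe (Fin m)) → Maybe (ℕ × Fin m)
firstNonBlank [] = nothing
firstNonBlank (just c ∷ s) = just (0 , c)
firstNonBlank (nothing ∷ s) = firstNonBlank s Data.Maybe.>>= λ { (k , c) → just (suc k , c) }

blankLeftmost : ∀ {m} → Fin m → List (Maybe (Fin m)) → Maybe (List (Maybe (Fin m)))
blankLeftmost l [] = nothing
blankLeftmost l (nothing ∷ s) = blankLeftmost l s Data.Maybe.>>= λ s' → just (nothing ∷ s')
blankLeftmost l (just x ∷ s) =
  if does (l ≟ x) then just (nothing ∷ s)
  else (blankLeftmost l s Data.Maybe.>>= λ s' → just (just x ∷ s'))

contains : ∀ {m} → Fin m → List (Maybe (Fin m)) → Bool
contains c [] = false
contains c (nothing ∷ s) = contains c s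
contains c (just x ∷ s) = if does (c ≟ x) then true else contains c s

firstSat : ∀ {A : Set} → (A → Bool) → List A → Maybe A
firstSat p [] = nothing
firstSat p (a ∷ as) = if p a then just a else firstSat p as

blankAll : ∀ {m} → List (Maybe (Fin m)) → List (Maybe (Fin m)) → Maybe (List (Maybe (Fin m)))
blankAll [] s = just s
blankAll (nothing ∷ b) s = blankAll b s
blankAll (just l ∷ b) s = blankLeftmost l s Data.Maybe.>>= blankAll b

record State (m n : ℕ) : Set where
  constructor st
  field
    str    : List (Maybe (Fin m))
    blocks : Vec (List (Maybe (Fin m))) n
    flags  : Vec Bool n

-- one iteration; returns the selected position (1-based) and the new state
step : ∀ {m n} → State m n → Maybe (ℕ × State m n)
step {m} {n} (st s bs fs) =
  firstNonBlank s Data.Maybe.>>= λ { (k , c) →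
  firstSat (λ j → if lookup fs j then false else contains c (lookup bs j)) (allFin n)
    Data.Maybe.>>= λ j →
  blankAll (lookup bs j) s Data.Maybe.>>= λ s' →
  blankLeftmost c (lookup bs j) Data.Maybe.>>= λ b' →
  just (suc k , st s' (bs [ j ]≔ b') (fs [ j ]≔ true)) }

iterate : ∀ {m n} (t : ℕ) → State m n → Maybe (Vec ℕ t)
iterate zero σ = just Vec.[]
iterate (suc t) s0 = step s0 Data.Maybe.>>= λ { (k , s1) →
  iterate t s1 Data.Maybe.>>= λ ks → just (k Vec.∷ ks) }

initState : ∀ {m M n} → Vec (Vec (Fin m) M) n → Fin m ↔ Fin m → State m n
initState X σ = st (List.map just (initS X σ))
                   (Vec.map (λ x → List.map just (toList x)) X)
                   (Vec.replicate _ false)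

runLFC : ∀ {m M n} → Vec (Vec (Fin m) M) n → Fin m ↔ Fin m → Maybe (Vec ℕ n)
runLFC {n = n} X σ = iterate n (initState X σ)

-- After t iterations S contains exactly t·M blanks: each iteration blanks in S one
-- copy of every letter of the flagged block, which is possible because the letters
-- of S are, with multiplicity, exactly those of the still unflagged blocks, and each
-- of these blocks still has all of its M letters. The selected position is the
-- first non-blank one, so it is at most t·M + 1.
module Submission where

open import Defs
open import Data.Nat using (ℕ; _≤_; _*_; _+_)
open import Data.Fin using (Fin; toℕ)
open import Data.Vec using (Vec; lookup)
open import Data.Maybe using (just)
open import Data.Product using (∃-syntax; _×_)
open import Function.Bundles using (_↔_)
open import Relation.Binary.PropositionalEquality using (_≡_)

open import Data.Nat using (zero; suc; _<_; s≤s; z≤n)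
open import Data.Nat.Properties
  using (+-identityʳ; +-comm; +-assoc; +-suc; +-cancelˡ-≤; +-cancelʳ-≡; ≤-trans; m≤m+n; m≤n+m; suc-injective; module ≤-Reasoning)
open import Data.Bool using (Bool; true; false; if_then_else_)
open import Data.Fin using (zero; suc)
open import Data.Fin.Properties using (_≟_)
import Data.Fin.Properties as Fin
import Data.List as List
open import Data.List using (List; []; _∷_; _++_; concat; tabulate; replicate; allFin; catMaybes; length)
open import Data.List.Properties using (map-tabulate)
open import Data.List.Membership.Propositional using (_∈_)
open import Data.List.Membership.Propositional.Properties using (∈-allFin)
open import Data.List.Relation.Unary.Any using (here; there)
import Data.Vec as Vec
open import Data.Vec using ([]; _∷_; _[_]≔_; toList)
open import Data.Vec.Properties using (lookup∘update; lookup∘update′; lookup-map; length-toList)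
open import Data.Maybe using (Maybe; nothing; _>>=_)
open import Data.Product using (_,_)
open import Function.Base using (_∘_; id)
open import Function.Bundles using (Inverse)
open import Relation.Nullary using (does; yes; no; contradiction)
open import Relation.Nullary.Decidable using (dec-true; dec-false)
open import Relation.Binary.PropositionalEquality using (refl; sym; trans; cong; cong₂; subst; _≢_; module ≡-Reasoning)

private
  variable
    m n : ℕ

Str : ℕ → Set
Str m = List (Maybe (Fin m))

count : Fin m → Str m → ℕ
count c s = countIn c (catMaybes s)

letters : Str m → ℕ
letters s = length (catMaybes s)

blanks : Str m → ℕ
blanks [] = 0
blanks (nothing ∷ s) = suc (blanks s)
blanks (just _ ∷ s) = blanks s

δ : Fin m → Fin m → ℕ
δ c x = if does (c ≟ x) then 1 else 0

countIn-∷ : ∀ (c x : Fin m) l → countIn c (x ∷ l) ≡ δ c x + countIn c l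
countIn-∷ c x l with does (c ≟ x)
... | true = refl
... | false = refl

count-just : ∀ (c x : Fin m) s → count c (just x ∷ s) ≡ δ c x + count c s
count-just c x s = countIn-∷ c x (catMaybes s)

count-here : ∀ (x : Fin m) s → 0 < count x (just x ∷ s)
count-here x s rewrite dec-true (x ≟ x) refl = s≤s z≤n

blankLeftmost-spec : ∀ (l : Fin m) s → 0 < count l s →
  ∃[ s' ] (blankLeftmost l s ≡ just s'
         × (∀ c → count c s' + δ c l ≡ count c s)
         × blanks s' ≡ suc (blanks s))
blankLeftmost-spec l (nothing ∷ s) l∈s with blankLeftmost-spec l s l∈s
... | s' , eq , counts , blanks≡ rewrite eq = nothing ∷ s' , refl , counts , cong suc blanks≡
blankLeftmost-spec l (just x ∷ s) l∈s with l ≟ x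
... | yes refl =
  nothing ∷ s , refl , (λ c → trans (+-comm (count c s) (δ c l)) (sym (count-just c l s))) , refl
... | no _ with blankLeftmost-spec l s l∈s
... | s' , eq , counts , blanks≡ rewrite eq = just x ∷ s' , refl , counts′ , blanks≡
  where
  open ≡-Reasoning
  counts′ : ∀ c → count c (just x ∷ s') + δ c l ≡ count c (just x ∷ s)
  counts′ c = begin
    count c (just x ∷ s') + δ c l       ≡⟨ cong (_+ δ c l) (count-just c x s') ⟩
    δ c x + count c s' + δ c l           ≡⟨ +-assoc (δ c x) _ _ ⟩
    δ c x + (count c s' + δ c l)         ≡⟨ cong (δ c x +_) (counts c) ⟩
    δ c x + count c s                    ≡⟨ count-just c x s ⟨
    count c (just x ∷ s)                 ∎

blankAll-spec : ∀ (b s : Str m) → (∀ c → count c b ≤ count c s) →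
  ∃[ s' ] (blankAll b s ≡ just s'
         × (∀ c → count c s' + count c b ≡ count c s)
         × blanks s' ≡ letters b + blanks s)
blankAll-spec [] s _ = s , refl , (λ c → +-identityʳ (count c s)) , refl
blankAll-spec (nothing ∷ b) s b⊆s = blankAll-spec b s b⊆s
blankAll-spec (just l ∷ b) s b⊆s with blankLeftmost-spec l s (≤-trans (count-here l b) (b⊆s l))
... | s₁ , eq₁ , counts₁ , blanks₁ with blankAll-spec b s₁ b⊆s₁
  where
  b⊆s₁ : ∀ c → count c b ≤ count c s₁
  b⊆s₁ c = +-cancelˡ-≤ (δ c l) _ _ (begin
    δ c l + count c b         ≡⟨ count-just c l b ⟨
    count c (just l ∷ b)      ≤⟨ b⊆s c ⟩
    count c s                 ≡⟨ counts₁ c ⟨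
    count c s₁ + δ c l        ≡⟨ +-comm (count c s₁) (δ c l) ⟩
    δ c l + count c s₁        ∎)
    where open ≤-Reasoning
... | s₂ , eq₂ , counts₂ , blanks₂ rewrite eq₁ = s₂ , eq₂ , counts , blanks≡
  where
  open ≡-Reasoning
  counts : ∀ c → count c s₂ + count c (just l ∷ b) ≡ count c s
  counts c = begin
    count c s₂ + count c (just l ∷ b) ≡⟨ cong (count c s₂ +_) (count-just c l b) ⟩
    count c s₂ + (δ c l + count c b)  ≡⟨ cong (count c s₂ +_) (+-comm (δ c l) _) ⟩
    count c s₂ + (count c b + δ c l)  ≡⟨ +-assoc (count c s₂) _ _ ⟨
    count c s₂ + count c b + δ c l    ≡⟨ cong (_+ δ c l) (counts₂ c) ⟩
    count c s₁ + δ c l                ≡⟨ counts₁ c ⟩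
    count c s                         ∎
  blanks≡ : blanks s₂ ≡ suc (letters b + blanks s)
  blanks≡ = trans blanks₂ (trans (cong (letters b +_) blanks₁) (+-suc (letters b) (blanks s)))

firstNonBlank-spec : ∀ (c : Fin m) s → 0 < count c s →
  ∃[ k ] ∃[ c' ] (firstNonBlank s ≡ just (k , c') × k ≤ blanks s × 0 < count c' s)
firstNonBlank-spec c (just x ∷ s) _ = 0 , x , refl , z≤n , count-here x s
firstNonBlank-spec c (nothing ∷ s) c∈s with firstNonBlank-spec c s c∈s
... | k , c' , eq , k≤ , c'∈s rewrite eq = suc k , c' , refl , s≤s k≤ , c'∈s

firstSat-complete : ∀ {A : Set} (p : A → Bool) {a} (l : List A) → a ∈ l → p a ≡ true →
  ∃[ b ] (firstSat p l ≡ just b × p b ≡ true)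
firstSat-complete p (x ∷ l) (here refl) pa rewrite pa = x , refl , pa
firstSat-complete p (x ∷ l) (there a∈l) pa with p x in px
... | true = x , refl , px
... | false = firstSat-complete p l a∈l pa

contains⇒0<count : ∀ (c : Fin m) b → contains c b ≡ true → 0 < count c b
contains⇒0<count c (nothing ∷ b) h = contains⇒0<count c b h
contains⇒0<count c (just x ∷ b) h with c ≟ x
... | yes _ = s≤s z≤n
... | no _ = contains⇒0<count c b h

0<count⇒contains : ∀ (c : Fin m) b → 0 < count c b → contains c b ≡ true
0<count⇒contains c (nothing ∷ b) h = 0<count⇒contains c b h
0<count⇒contains c (just x ∷ b) h with c ≟ x
... | yes _ = refl
... | no _ = 0<count⇒contains c b h

0<letters⇒occurs : ∀ (b : Str m) → 0 < letters b → ∃[ c ] 0 < count c b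
0<letters⇒occurs (nothing ∷ b) h = 0<letters⇒occurs b h
0<letters⇒occurs (just x ∷ b) _ = x , count-here x b

unflaggedCount : Fin m → Vec (Str m) n → Vec Bool n → ℕ
unflaggedCount c [] [] = 0
unflaggedCount c (b ∷ bs) (f ∷ fs) = (if f then 0 else count c b) + unflaggedCount c bs fs

#unflagged : Vec Bool n → ℕ
#unflagged [] = 0
#unflagged (true ∷ fs) = #unflagged fs
#unflagged (false ∷ fs) = suc (#unflagged fs)

count≤unflaggedCount : ∀ (c : Fin m) (bs : Vec (Str m) n) fs j → lookup fs j ≡ false →
  count c (lookup bs j) ≤ unflaggedCount c bs fs
count≤unflaggedCount c (b ∷ bs) (false ∷ fs) zero refl = m≤m+n (count c b) _
count≤unflaggedCount c (b ∷ bs) (f ∷ fs) (suc j) j-unfl =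
  ≤-trans (count≤unflaggedCount c bs fs j j-unfl) (m≤n+m _ _)

0<unflaggedCount⇒occurs : ∀ (c : Fin m) (bs : Vec (Str m) n) fs → 0 < unflaggedCount c bs fs →
  ∃[ j ] (lookup fs j ≡ false × 0 < count c (lookup bs j))
0<unflaggedCount⇒occurs c [] [] ()
0<unflaggedCount⇒occurs c (b ∷ bs) (true ∷ fs) h with 0<unflaggedCount⇒occurs c bs fs h
... | j , j-unfl , c∈j = suc j , j-unfl , c∈j
0<unflaggedCount⇒occurs c (b ∷ bs) (false ∷ fs) h with count c b in c∈b
... | suc _ = zero , refl , subst (0 <_) (sym c∈b) (s≤s z≤n)
... | zero with 0<unflaggedCount⇒occurs c bs fs h
... | j , j-unfl , c∈j = suc j , j-unfl , c∈j

unflaggedCount-flag : ∀ (c : Fin m) (bs : Vec (Str m) n) fs j b' → lookup fs j ≡ false →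
  unflaggedCount c (bs [ j ]≔ b') (fs [ j ]≔ true) + count c (lookup bs j) ≡ unflaggedCount c bs fs
unflaggedCount-flag c (b ∷ bs) (false ∷ fs) zero b' refl = +-comm (unflaggedCount c bs fs) (count c b)
unflaggedCount-flag c (b ∷ bs) (f ∷ fs) (suc j) b' j-unfl =
  trans (+-assoc (if f then 0 else count c b) _ _)
        (cong ((if f then 0 else count c b) +_) (unflaggedCount-flag c bs fs j b' j-unfl))

#unflagged-flag : ∀ (fs : Vec Bool n) j → lookup fs j ≡ false → suc (#unflagged (fs [ j ]≔ true)) ≡ #unflagged fs
#unflagged-flag (false ∷ fs) zero refl = refl
#unflagged-flag (true ∷ fs) (suc j) j-unfl = #unflagged-flag fs j j-unfl
#unflagged-flag (false ∷ fs) (suc j) j-unfl = cong suc (#unflagged-flag fs j j-unfl)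

0<#unflagged⇒unflagged : ∀ (fs : Vec Bool n) → 0 < #unflagged fs → ∃[ j ] lookup fs j ≡ false
0<#unflagged⇒unflagged [] ()
0<#unflagged⇒unflagged (true ∷ fs) h with 0<#unflagged⇒unflagged fs h
... | j , j-unfl = suc j , j-unfl
0<#unflagged⇒unflagged (false ∷ fs) _ = zero , refl

-- t iterations have been performed and r blocks are still unflagged.
record Invariant (M t r : ℕ) (S : State m n) : Set where
  field
    count-str : ∀ c → count c (State.str S) ≡ unflaggedCount c (State.blocks S) (State.flags S)
    blanks-str : blanks (State.str S) ≡ t * M
    letters-unflagged : ∀ j → lookup (State.flags S) j ≡ false → letters (lookup (State.blocks S) j) ≡ M
    #unflagged-flags : #unflagged (State.flags S) ≡ r

selectable : Fin m → Vec (Str m) n → Vec Bool n → Fin n → Bool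
selectable c bs fs j = if lookup fs j then false else contains c (lookup bs j)

selectable⇒unflagged : ∀ (c : Fin m) (bs : Vec (Str m) n) fs j → selectable c bs fs j ≡ true →
  lookup fs j ≡ false × 0 < count c (lookup bs j)
selectable⇒unflagged c bs fs j h with lookup fs j
... | false = refl , contains⇒0<count c (lookup bs j) h

unflagged⇒selectable : ∀ (c : Fin m) (bs : Vec (Str m) n) fs j →
  lookup fs j ≡ false → 0 < count c (lookup bs j) → selectable c bs fs j ≡ true
unflagged⇒selectable c bs fs j j-unfl c∈j rewrite j-unfl = 0<count⇒contains c (lookup bs j) c∈j

firstSelectable-spec : ∀ (c : Fin m) (bs : Vec (Str m) n) fs → 0 < unflaggedCount c bs fs →
  ∃[ j ] (firstSat (selectable c bs fs) (allFin n) ≡ just j × lookup fs j ≡ false × 0 < count c (lookup bs j))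
firstSelectable-spec c bs fs c∈
  with j₀ , j₀-unfl , c∈j₀ ← 0<unflaggedCount⇒occurs c bs fs c∈
  with j , first≡ , j-sel ← firstSat-complete (selectable c bs fs) (allFin _) (∈-allFin j₀)
                              (unflagged⇒selectable c bs fs j₀ j₀-unfl c∈j₀)
  = j , first≡ , selectable⇒unflagged c bs fs j j-sel

step-unfold : ∀ {s : Str m} {bs : Vec (Str m) n} {fs k c j s' b'} →
  firstNonBlank s ≡ just (k , c) → firstSat (selectable c bs fs) (allFin n) ≡ just j →
  blankAll (lookup bs j) s ≡ just s' → blankLeftmost c (lookup bs j) ≡ just b' →
  step (st s bs fs) ≡ just (suc k , st s' (bs [ j ]≔ b') (fs [ j ]≔ true))
step-unfold first≡ select≡ blankAll≡ blankLeftmost≡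
  rewrite first≡ | select≡ | blankAll≡ | blankLeftmost≡ = refl

module _ {M t r : ℕ} {s : Str m} {bs : Vec (Str m) n} {fs : Vec Bool n}
         (inv : Invariant M t (suc r) (st s bs fs)) where
  open Invariant inv

  count-unflagged≤count-str : ∀ c j → lookup fs j ≡ false → count c (lookup bs j) ≤ count c s
  count-unflagged≤count-str c j j-unfl =
    subst (count c (lookup bs j) ≤_) (sym (count-str c)) (count≤unflaggedCount c bs fs j j-unfl)

  some-letter : 1 ≤ M → ∃[ c ] 0 < count c s
  some-letter 1≤M
    with j , j-unfl ← 0<#unflagged⇒unflagged fs (subst (0 <_) (sym #unflagged-flags) (s≤s z≤n))
    with c , c∈j ← 0<letters⇒occurs (lookup bs j) (subst (0 <_) (sym (letters-unflagged j j-unfl)) 1≤M)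
    = c , ≤-trans c∈j (count-unflagged≤count-str c j j-unfl)

  flag-preserves-invariant : ∀ {s' : Str m} j b' → lookup fs j ≡ false →
    (∀ c → count c s' + count c (lookup bs j) ≡ count c s) →
    blanks s' ≡ letters (lookup bs j) + blanks s →
    Invariant M (suc t) r (st s' (bs [ j ]≔ b') (fs [ j ]≔ true))
  flag-preserves-invariant j b' j-unfl counts blanks≡ = record
    { count-str = λ c → +-cancelʳ-≡ (count c (lookup bs j)) _ _
        (trans (counts c) (trans (count-str c) (sym (unflaggedCount-flag c bs fs j b' j-unfl))))
    ; blanks-str = trans blanks≡ (cong₂ _+_ (letters-unflagged j j-unfl) blanks-str)
    ; letters-unflagged = letters-still-unflagged
    ; #unflagged-flags = suc-injective (trans (#unflagged-flag fs j j-unfl) #unflagged-flags)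
    }
    where
    letters-still-unflagged : ∀ j' → lookup (fs [ j ]≔ true) j' ≡ false → letters (lookup (bs [ j ]≔ b') j') ≡ M
    letters-still-unflagged j' j'-unfl with j ≟ j'
    ... | yes refl = contradiction (trans (sym (lookup∘update j fs true)) j'-unfl) λ ()
    ... | no j≢j' = trans (cong letters (lookup∘update′ (j≢j' ∘ sym) bs b'))
                          (letters-unflagged j' (trans (sym (lookup∘update′ (j≢j' ∘ sym) fs true)) j'-unfl))

  step-spec : 1 ≤ M →
    ∃[ k ] ∃[ S' ] (step (st s bs fs) ≡ just (suc k , S') × k ≤ t * M × Invariant M (suc t) r S')
  step-spec 1≤M
    with c₀ , c₀∈s ← some-letter 1≤M
    with k , c , first≡ , k≤ , c∈s ← firstNonBlank-spec c₀ s c₀∈s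
    with j , select≡ , j-unfl , c∈j ← firstSelectable-spec c bs fs (subst (0 <_) (count-str c) c∈s)
    with s' , blankAll≡ , counts , blanks≡ ← blankAll-spec (lookup bs j) s (λ c' → count-unflagged≤count-str c' j j-unfl)
    with b' , blankLeftmost≡ , _ ← blankLeftmost-spec c (lookup bs j) c∈j
    = k , st s' (bs [ j ]≔ b') (fs [ j ]≔ true) ,
      step-unfold first≡ select≡ blankAll≡ blankLeftmost≡ ,
      subst (k ≤_) blanks-str k≤ ,
      flag-preserves-invariant j b' j-unfl counts blanks≡

>>=-just : ∀ {A B : Set} {mx : Maybe A} {a} (f : A → Maybe B) → mx ≡ just a → (mx >>= f) ≡ f a
>>=-just f refl = refl

bounds-cons : ∀ M t {k r} {ks : Vec ℕ r} → k ≤ t * M →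
  (∀ (i : Fin r) → lookup ks i ≤ (suc t + toℕ i) * M + 1) →
  ∀ (i : Fin (suc r)) → lookup (suc k ∷ ks) i ≤ (t + toℕ i) * M + 1
bounds-cons M t k≤ ks≤ zero rewrite +-identityʳ t | +-comm (t * M) 1 = s≤s k≤
bounds-cons M t k≤ ks≤ (suc i) rewrite +-suc t (toℕ i) = ks≤ i

iterate-spec : ∀ {M} r t (S : State m n) → 1 ≤ M → Invariant M t r S →
  ∃[ ks ] (iterate r S ≡ just ks × (∀ (i : Fin r) → lookup ks i ≤ (t + toℕ i) * M + 1))
iterate-spec zero t S _ _ = [] , refl , λ ()
iterate-spec {M = M} (suc r) t S 1≤M inv =
  let k , S' , step≡ , k≤ , inv' = step-spec inv 1≤M
      ks , iterate≡ , ks≤ = iterate-spec r (suc t) S' 1≤M inv'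
  in suc k ∷ ks , trans (>>=-just _ step≡) (>>=-just _ iterate≡) , bounds-cons M t k≤ ks≤

catMaybes-map-just : ∀ {A : Set} (l : List A) → catMaybes (List.map just l) ≡ l
catMaybes-map-just [] = refl
catMaybes-map-just (x ∷ l) = cong (x ∷_) (catMaybes-map-just l)

blanks-map-just : ∀ (l : List (Fin m)) → blanks (List.map just l) ≡ 0
blanks-map-just [] = refl
blanks-map-just (x ∷ l) = blanks-map-just l

countIn-++ : ∀ (c : Fin m) xs ys → countIn c (xs ++ ys) ≡ countIn c xs + countIn c ys
countIn-++ c [] ys = refl
countIn-++ c (x ∷ xs) ys
  rewrite countIn-∷ c x (xs ++ ys) | countIn-∷ c x xs | countIn-++ c xs ys =
  sym (+-assoc (δ c x) _ _)

countIn-replicate : ∀ (c : Fin m) k → countIn c (replicate k c) ≡ k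
countIn-replicate c zero = refl
countIn-replicate c (suc k) rewrite dec-true (c ≟ c) refl = cong suc (countIn-replicate c k)

countIn-replicate-≢ : ∀ {c x : Fin m} k → c ≢ x → countIn c (replicate k x) ≡ 0
countIn-replicate-≢ zero _ = refl
countIn-replicate-≢ {c = c} {x} (suc k) c≢x rewrite dec-false (c ≟ x) c≢x = countIn-replicate-≢ k c≢x

countIn-concat-tabulate-0 : ∀ {k} (c : Fin m) (g : Fin k → List (Fin m)) →
  (∀ i → countIn c (g i) ≡ 0) → countIn c (concat (tabulate g)) ≡ 0
countIn-concat-tabulate-0 {k = zero} c g _ = refl
countIn-concat-tabulate-0 {k = suc k} c g g₀ =
  trans (countIn-++ c (g zero) _) (cong₂ _+_ (g₀ zero) (countIn-concat-tabulate-0 c (g ∘ suc) (g₀ ∘ suc)))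

countIn-concat-tabulate-single : ∀ {k} (c : Fin m) (g : Fin k → List (Fin m)) i₀ →
  (∀ i → i ≢ i₀ → countIn c (g i) ≡ 0) → countIn c (concat (tabulate g)) ≡ countIn c (g i₀)
countIn-concat-tabulate-single c g zero g₀ =
  trans (countIn-++ c (g zero) _)
    (trans (cong (countIn c (g zero) +_) (countIn-concat-tabulate-0 c (g ∘ suc) (λ i → g₀ (suc i) λ ())))
      (+-identityʳ _))
countIn-concat-tabulate-single c g (suc i₀) g₀ =
  trans (countIn-++ c (g zero) _)
    (cong₂ _+_ (g₀ zero λ ())
      (countIn-concat-tabulate-single c (g ∘ suc) i₀ (λ i i≢i₀ → g₀ (suc i) (i≢i₀ ∘ Fin.suc-injective))))

countIn-initS : ∀ {M n} (X : Vec (Vec (Fin m) M) n) (σ : Fin m ↔ Fin m) c → countIn c (initS X σ) ≡ occ c X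
countIn-initS {m} X σ c = begin
  countIn c (concat (List.map copies (allFin m)))     ≡⟨ cong (countIn c ∘ concat) (map-tabulate id copies) ⟩
  countIn c (concat (tabulate copies))                ≡⟨ countIn-concat-tabulate-single c copies (to c) others ⟩
  countIn c (copies (to c))                           ≡⟨ cong (λ y → countIn c (replicate (occ y X) y)) (strictlyInverseʳ c) ⟩
  countIn c (replicate (occ c X) c)                   ≡⟨ countIn-replicate c (occ c X) ⟩
  occ c X                                             ∎
  where
  open Inverse σ
  open ≡-Reasoning
  copies : Fin m → List (Fin m)
  copies i = replicate (occ (from i) X) (from i)
  others : ∀ i → i ≢ to c → countIn c (copies i) ≡ 0
  others i i≢ = countIn-replicate-≢ (occ (from i) X) λ c≡ → i≢ (trans (sym (strictlyInverseˡ i)) (cong to (sym c≡)))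

initBlock : ∀ {M} → Vec (Fin m) M → Str m
initBlock x = List.map just (toList x)

unflaggedCount-init : ∀ {M n} (X : Vec (Vec (Fin m) M) n) c →
  unflaggedCount c (Vec.map initBlock X) (Vec.replicate n false) ≡ occ c X
unflaggedCount-init [] c = refl
unflaggedCount-init (x ∷ X) c =
  trans (cong₂ _+_ (cong (countIn c) (catMaybes-map-just (toList x))) (unflaggedCount-init X c))
        (sym (countIn-++ c (toList x) (flat X)))

#unflagged-replicate : ∀ n → #unflagged (Vec.replicate n false) ≡ n
#unflagged-replicate zero = refl
#unflagged-replicate (suc n) = cong suc (#unflagged-replicate n)

initState-invariant : ∀ {M n} (X : Vec (Vec (Fin m) M) n) (σ : Fin m ↔ Fin m) → Invariant M 0 n (initState X σ)
initState-invariant {n = n} X σ = record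
  { count-str = λ c → trans (cong (countIn c) (catMaybes-map-just (initS X σ)))
                            (trans (countIn-initS X σ c) (sym (unflaggedCount-init X c)))
  ; blanks-str = blanks-map-just (initS X σ)
  ; letters-unflagged = λ j _ → trans (cong letters (lookup-map j initBlock X))
                                  (trans (cong length (catMaybes-map-just (toList (lookup X j))))
                                         (length-toList (lookup X j)))
  ; #unflagged-flags = #unflagged-replicate n
  }

lemma8 : ∀ {m} (M n : ℕ) → 2 ≤ M → (X : Vec (Vec (Fin m) M) n) → (σ : Fin m ↔ Fin m) →
    IsLFC X σ →
    ∃[ ks ] (runLFC X σ ≡ just ks × (∀ (i : Fin n) → lookup ks i ≤ toℕ i * M + 1))
lemma8 M n (s≤s _) X σ _ = iterate-spec n 0 (initState X σ) (s≤s z≤n) (initState-invariant X σ)
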